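{- For all integers $j,k\ge 1$ and $m\ge 0$, \[ w_{2k+j,k,m}=\frac{1}{j}\binom{2k+j}{k-1}N^{(j-1)}_{k+j-1,m},\] and for all integers $1\le j\le k$ and $m\ge 0$, \[ w_{2k-j,k,m}=\frac{1}{j}\binom{2k-j}{k-1}N^{(j-1)}_{k-1,m}.\]
   Context: A Dyck path of semilength $n$ is a word in the letters $U,D$ with $n$ copies of each letter such that no prefix contains more $D$'s than $U$'s. A $UD$-factor (resp. $UUD$-factor) is an occurrence of $UD$ (resp. $UUD$) as a consecutive subword. $w_{n,k,m}$ denotes the number of Dyck paths of semilength $n$ with exactly $k$ $UD$-factors and exactly $m$ $UUD$-factors. For $0\le r\le n$ and $0\le i\le n-r$, the $r$-generalized Narayana number is $N^{(r)}_{n,i}=\frac{r+1}{n+1}\binom{n+1}{i}\binom{n-r-1}{i-1}$, with the convention that $\binom{a}{b}=0$ for $b<0$ except $\binom{ -1}{ -1}=1$; for $i>n-r$ we take $N^{(r)}_{n,i}=0$. -}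

module Defs where

open import Data.Nat using (ℕ; zero; suc; _+_; _∸_; _≡ᵇ_; _<ᵇ_)
open import Data.Nat.Combinatorics using (_C_)
open import Data.Integer using (ℤ; +_; -[1+_]; _-_)
open import Data.Bool using (Bool; true; false; if_then_else_; _∧_)
open import Data.List using (List; []; _∷_; length; filterᵇ; map; concatMap; _++_)
open import Data.Rational using (ℚ; 0ℚ; _*_)
import Data.Rational as ℚ

data Step : Set where
  U D : Step

words : ℕ → List (List Step)
words zero = [] ∷ []
words (suc ℓ) = map (U ∷_) (words ℓ) ++ map (D ∷_) (words ℓ)

ballot : ℕ → List Step → Bool
ballot h [] = h ≡ᵇ 0
ballot h (U ∷ w) = ballot (suc h) w
ballot zero (D ∷ w) = false
ballot (suc h) (D ∷ w) = ballot h w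

isDyck : List Step → Bool
isDyck = ballot 0

countUD : List Step → ℕ
countUD (U ∷ D ∷ w) = suc (countUD (D ∷ w))
countUD [] = 0
countUD (_ ∷ w) = countUD w

countUUD : List Step → ℕ
countUUD (U ∷ U ∷ D ∷ w) = suc (countUUD (U ∷ D ∷ w))
countUUD [] = 0
countUUD (_ ∷ w) = countUUD w

w : ℕ → ℕ → ℕ → ℕ
w n k m = length (filterᵇ (λ p → isDyck p ∧ (countUD p ≡ᵇ k) ∧ (countUUD p ≡ᵇ m))
                          (words (2 Data.Nat.* n)))

-- binomial coefficient with integer arguments, convention:
-- binom a b = 0 for b < 0 except binom (-1) (-1) = 1.
-- (For a < 0 ≤ b the value is never used in the statement; we set it to 0.)
binomZ : ℤ → ℤ → ℕ
binomZ (+ a) (+ b) = a C b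
binomZ -[1+ 0 ] -[1+ 0 ] = 1
binomZ _ -[1+ _ ] = 0
binomZ -[1+ _ ] (+ _) = 0

-- 1/n as a rational, for n ≥ 1 (value 0 at n = 0, never used)
recip : ℕ → ℚ
recip zero = 0ℚ
recip (suc n) = (+ 1) ℚ./ suc n

toℚ : ℕ → ℚ
toℚ n = (+ n) ℚ./ 1

narayana : ℕ → ℕ → ℕ → ℚ
narayana r n i =
  if (n ∸ r) <ᵇ i then 0ℚ
  else toℚ (suc r) * recip (suc n) * toℚ ((suc n) C i)
         * toℚ (binomZ ((+ n) - (+ r) - (+ 1)) ((+ i) - (+ 1)))

-- A Dyck path with k peaks splits into k ascending runs, which form a composition of n into k
-- parts, and the descents between them; its UUD factors are the runs of length at least 2. For a
-- fixed composition of the ascents the admissible descents are counted by a ballot number, so that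
-- k·w(n,k,m) = C(n,k-1)·c(n,k,m), where c(n,k,m) = C(k,m)·C(n-k-1,m-1) counts the compositions of n
-- into k parts with exactly m parts at least 2. To prove this, paths are counted from an arbitrary
-- starting height h by a transfer recursion remembering the length of the current run; for these
-- counts a ballot formula with the factor h+1 holds and is proved by simultaneous induction over
-- the run states. Both identities then reduce to binomial algebra on the explicit Narayana numbers.

module Submission where

open import Defs
open import Data.Bool using (Bool; true; false; if_then_else_; _∧_; T; T?)
open import Data.Bool.Properties using (∧-zeroʳ)
open import Data.Integer using (+_) renaming (_-_ to _-ℤ_)
import Data.Integer.Properties as ℤ
open import Data.List using (List; []; _∷_; _++_; length; map; filterᵇ)
open import Data.List.Properties using (length-++; length-map; filter-++)
open import Data.Nat
  using (ℕ; zero; suc; _+_; _*_; _∸_; _<_; _≤_; _≡ᵇ_; _<ᵇ_; s≤s; z≤n; compare; less; equal; greater)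
open import Data.Nat.Properties
open import Data.Nat.Combinatorics using (_C_; k>n⇒nCk≡0; nCk+nC[k+1]≡[n+1]C[k+1])
open import Data.Nat.Tactic.RingSolver using (solve)
open import Data.Product using (_×_; _,_)
open import Data.Rational using (ℚ; 0ℚ; 1ℚ; fromℚᵘ) renaming (_*_ to _*ℚ_)
import Data.Rational.Properties as ℚ
open import Data.Rational.Unnormalised.Base using (mkℚᵘ) renaming (_*_ to _*ᵘ_)
import Data.Rational.Unnormalised.Properties as ℚᵘ
open import Data.Sum using (_⊎_; inj₁; inj₂)
open import Data.Unit using (tt)
open import Function using (_∘_)
open import Relation.Binary.PropositionalEquality
  using (_≡_; refl; sym; trans; cong; cong₂; subst; subst₂)
open import Relation.Binary.PropositionalEquality.Properties using (module ≡-Reasoning)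
open import Algebra.Properties.CommutativeSemigroup *-commutativeSemigroup using (x∙yz≈y∙xz)
open import Algebra.Solver.CommutativeMonoid ℚ.*-1-commutativeMonoid
  using (_⊕_; _⊜_) renaming (solve to ℚ-solve)

open ≡-Reasoning

module _ {A : Set} where

  length-filterᵇ-++ : ∀ (p : A → Bool) xs ys →
    length (filterᵇ p (xs ++ ys)) ≡ length (filterᵇ p xs) + length (filterᵇ p ys)
  length-filterᵇ-++ p xs ys =
    trans (cong length (filter-++ (T? ∘ p) xs ys)) (length-++ (filterᵇ p xs))

  filterᵇ-map : ∀ {B : Set} (p : B → Bool) (f : A → B) xs →
    filterᵇ p (map f xs) ≡ map f (filterᵇ (p ∘ f) xs)
  filterᵇ-map p f [] = refl
  filterᵇ-map p f (x ∷ xs) with p (f x)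
  ... | true = cong (f x ∷_) (filterᵇ-map p f xs)
  ... | false = filterᵇ-map p f xs

  length-filterᵇ-map : ∀ {B : Set} (p : B → Bool) (f : A → B) xs →
    length (filterᵇ p (map f xs)) ≡ length (filterᵇ (p ∘ f) xs)
  length-filterᵇ-map p f xs =
    trans (cong length (filterᵇ-map p f xs)) (length-map f (filterᵇ (p ∘ f) xs))

  length-filterᵇ-none : ∀ (p : A → Bool) → (∀ x → p x ≡ false) → ∀ xs → length (filterᵇ p xs) ≡ 0
  length-filterᵇ-none p reject [] = refl
  length-filterᵇ-none p reject (x ∷ xs) rewrite reject x = length-filterᵇ-none p reject xs

-- Paths from an arbitrary height, by a transfer recursion

-- The length of the current run of U's, capped at two: enough to recognise UD and UUD factors.
data Run : Set where
  none one many : Run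

push : Run → Run
push none = one
push one = many
push many = many

trail : Run → List Step
trail none = []
trail one = U ∷ []
trail many = U ∷ U ∷ []

-- Factors are counted on the trail of the current run followed by the rest of the path,
-- so that a factor straddling the cut is seen.
accepts : Run → ℕ → ℕ → ℕ → List Step → Bool
accepts r h k m p = ballot h p ∧ (countUD (trail r ++ p) ≡ᵇ k) ∧ (countUUD (trail r ++ p) ≡ᵇ m)

count : Run → ℕ → ℕ → ℕ → ℕ → ℕ
count r h ℓ k m = length (filterᵇ (accepts r h k m) (words ℓ))

-- A D-step ends the current run: it creates a UD factor unless the run is empty,
-- and a UUD factor if the run is long.
closeRun : Run → (ℕ → ℕ → ℕ) → ℕ → ℕ → ℕ
closeRun none f k m = f k m
closeRun one f zero m = 0
closeRun one f (suc k) m = f k m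
closeRun many f zero m = 0
closeRun many f (suc k) zero = 0
closeRun many f (suc k) (suc m) = f k m

closeRun-cong : ∀ r {f g : ℕ → ℕ → ℕ} → (∀ k m → f k m ≡ g k m) →
  ∀ k m → closeRun r f k m ≡ closeRun r g k m
closeRun-cong none f≡g k m = f≡g k m
closeRun-cong one f≡g zero m = refl
closeRun-cong one f≡g (suc k) m = f≡g k m
closeRun-cong many f≡g zero m = refl
closeRun-cong many f≡g (suc k) zero = refl
closeRun-cong many f≡g (suc k) (suc m) = f≡g k m

closeRun-zero : ∀ r k m → closeRun r (λ _ _ → 0) k m ≡ 0
closeRun-zero none k m = refl
closeRun-zero one zero m = refl
closeRun-zero one (suc k) m = refl
closeRun-zero many zero m = refl
closeRun-zero many (suc k) zero = refl
closeRun-zero many (suc k) (suc m) = refl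

countD : Run → ℕ → ℕ → ℕ → ℕ → ℕ
countD r zero ℓ = λ _ _ → 0
countD r (suc h) ℓ = closeRun r (count none h ℓ)

count-U : ∀ r h ℓ k m →
  length (filterᵇ (accepts r h k m ∘ (U ∷_)) (words ℓ)) ≡ count (push r) (suc h) ℓ k m
count-U none h ℓ k m = refl
count-U one h ℓ k m = refl
count-U many h ℓ k m = refl

count-D : ∀ r h ℓ k m → length (filterᵇ (accepts r h k m ∘ (D ∷_)) (words ℓ)) ≡ countD r h ℓ k m
count-D r zero ℓ k m = length-filterᵇ-none _ (λ _ → refl) (words ℓ)
count-D none (suc h) ℓ k m = refl
count-D one (suc h) ℓ zero m =
  length-filterᵇ-none (accepts one (suc h) zero m ∘ (D ∷_)) (λ p → ∧-zeroʳ (ballot h p)) (words ℓ)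
count-D one (suc h) ℓ (suc k) m = refl
count-D many (suc h) ℓ zero m =
  length-filterᵇ-none (accepts many (suc h) zero m ∘ (D ∷_)) (λ p → ∧-zeroʳ (ballot h p)) (words ℓ)
count-D many (suc h) ℓ (suc k) zero =
  length-filterᵇ-none (accepts many (suc h) (suc k) zero ∘ (D ∷_))
    (λ p → trans (cong (ballot h p ∧_) (∧-zeroʳ (countUD p ≡ᵇ k))) (∧-zeroʳ (ballot h p))) (words ℓ)
count-D many (suc h) ℓ (suc k) (suc m) = refl

count-suc : ∀ r h ℓ k m → count r h (suc ℓ) k m ≡ count (push r) (suc h) ℓ k m + countD r h ℓ k m
count-suc r h ℓ k m =
  trans (length-filterᵇ-++ (accepts r h k m) (map (U ∷_) (words ℓ)) (map (D ∷_) (words ℓ)))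
        (cong₂ _+_ (trans (length-filterᵇ-map (accepts r h k m) (U ∷_) (words ℓ)) (count-U r h ℓ k m))
                   (trans (length-filterᵇ-map (accepts r h k m) (D ∷_) (words ℓ)) (count-D r h ℓ k m)))

count-short : ∀ r h ℓ k m → ℓ < h → count r h ℓ k m ≡ 0
count-short r (suc h) zero k m _ = refl
count-short r (suc h) (suc ℓ) k m (s≤s ℓ<h) = trans (count-suc r (suc h) ℓ k m)
  (cong₂ _+_ (count-short (push r) (suc (suc h)) ℓ k m (m≤n⇒m≤1+n (m≤n⇒m≤1+n ℓ<h)))
             (trans (closeRun-cong r (λ k m → count-short none h ℓ k m ℓ<h) k m) (closeRun-zero r k m)))

empty : ℕ → ℕ → ℕ
empty zero zero = 1
empty zero (suc m) = 0
empty (suc k) m = 0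

count-nil : ∀ r k m → count r 0 0 k m ≡ empty k m
count-nil none zero zero = refl
count-nil none zero (suc m) = refl
count-nil none (suc k) m = refl
count-nil one zero zero = refl
count-nil one zero (suc m) = refl
count-nil one (suc k) m = refl
count-nil many zero zero = refl
count-nil many zero (suc m) = refl
count-nil many (suc k) m = refl

-- The same count, indexed by the number u of U-steps still to come (the length is 2u + h).
paths : Run → ℕ → ℕ → ℕ → ℕ → ℕ
paths r zero zero = empty
paths r (suc h) zero = closeRun r (paths none h zero)
paths r zero (suc u) = paths (push r) 1 u
paths r (suc h) (suc u) k m = paths (push r) (suc (suc h)) u k m + closeRun r (paths none h (suc u)) k m

-- span u h = 2u + h, by the recursion along which paths unfolds.
span : ℕ → ℕ → ℕ
span zero h = h
span (suc u) h = suc (span u (suc h))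

span-suc : ∀ u h → span u (suc h) ≡ suc (span u h)
span-suc zero h = refl
span-suc (suc u) h = cong suc (span-suc u (suc h))

span-double : ∀ u → span u 0 ≡ 2 * u
span-double zero = refl
span-double (suc u) = begin
  suc (span u 1)          ≡⟨ cong suc (span-suc u 0) ⟩
  suc (suc (span u 0))    ≡⟨ cong (suc ∘ suc) (span-double u) ⟩
  suc (suc (2 * u))       ≡⟨ cong suc (sym (+-suc u (u + 0))) ⟩
  2 * suc u               ∎

count≡paths : ∀ r h u k m → count r h (span u h) k m ≡ paths r h u k m
count≡paths r zero zero k m = count-nil r k m
count≡paths r (suc h) zero k m = trans (count-suc r (suc h) h k m)
  (cong₂ _+_ (count-short (push r) (suc (suc h)) h k m (m≤n⇒m≤1+n ≤-refl))
             (closeRun-cong r (count≡paths none h zero) k m))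
count≡paths r zero (suc u) k m = trans (count-suc r zero (span u 1) k m)
  (trans (+-identityʳ _) (count≡paths (push r) 1 u k m))
count≡paths r (suc h) (suc u) k m = trans (count-suc r (suc h) (span u (suc (suc h))) k m)
  (cong₂ _+_ (count≡paths (push r) (suc (suc h)) u k m)
             (trans (cong (λ ℓ → closeRun r (count none h ℓ) k m) (span-suc u (suc h)))
                    (closeRun-cong r (count≡paths none h (suc u)) k m)))

w≡paths : ∀ n k m → w n k m ≡ paths none 0 n k m
w≡paths n k m = trans (cong (λ ℓ → count none 0 ℓ k m) (sym (span-double n))) (count≡paths none 0 n k m)

-- Binomial coefficients

-- Pascal's recursion, so that the recurrences below hold definitionally.
binom : ℕ → ℕ → ℕ
binom n zero = 1
binom zero (suc k) = 0
binom (suc n) (suc k) = binom n k + binom n (suc k)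

binom≡C : ∀ n k → binom n k ≡ n C k
binom≡C n zero = refl
binom≡C zero (suc k) = sym (k>n⇒nCk≡0 {0} {suc k} (s≤s z≤n))
binom≡C (suc n) (suc k) =
  trans (cong₂ _+_ (binom≡C n k) (binom≡C n (suc k))) (nCk+nC[k+1]≡[n+1]C[k+1] n k)

binom-1 : ∀ n → binom n 1 ≡ n
binom-1 zero = refl
binom-1 (suc n) = cong suc (binom-1 n)

binom-absorb : ∀ n k → suc k * binom (suc n) (suc k) ≡ suc n * binom n k
binom-absorb zero zero = refl
binom-absorb zero (suc k) = *-zeroʳ (suc (suc k))
binom-absorb (suc n) zero =
  cong suc (trans (+-identityʳ _) (trans (binom-1 (suc n)) (sym (*-identityʳ (suc n)))))
binom-absorb (suc n) (suc k) = begin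
  suc (suc k) * (a + b)                               ≡⟨ distribute k a b ⟩
  a + (suc k * a + suc (suc k) * b)                   ≡⟨ cong₂ (λ p q → a + (p + q)) (binom-absorb n k)
                                                                                      (binom-absorb n (suc k)) ⟩
  a + (suc n * binom n k + suc n * binom n (suc k))   ≡⟨ cong (λ x → a + x)
                                                          (sym (*-distribˡ-+ (suc n) (binom n k) (binom n (suc k)))) ⟩
  suc (suc n) * a                                     ∎
  where
  a b : ℕ
  a = binom (suc n) (suc k)
  b = binom (suc n) (suc (suc k))
  distribute : ∀ k a b → suc (suc k) * (a + b) ≡ a + (suc k * a + suc (suc k) * b)
  distribute k a b = solve (k ∷ a ∷ b ∷ [])

binom-absorb-complement : ∀ k d → suc (k + d) * binom (k + d) k ≡ suc d * binom (suc (k + d)) k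
binom-absorb-complement zero d = refl
binom-absorb-complement (suc k) d = +-cancelʳ-≡ (suc k * X) _ _ (begin
  suc N * binom N (suc k) + suc k * X          ≡⟨ cong (λ x → suc N * binom N (suc k) + x) (binom-absorb N k) ⟩
  suc N * binom N (suc k) + suc N * binom N k  ≡⟨ sym (*-distribˡ-+ (suc N) (binom N (suc k)) (binom N k)) ⟩
  suc N * (binom N (suc k) + binom N k)        ≡⟨ cong (suc N *_) (+-comm (binom N (suc k)) (binom N k)) ⟩
  suc N * X                                    ≡⟨ distribute k d X ⟩
  suc d * X + suc k * X                        ∎)
  where
  N X : ℕ
  N = suc k + d
  X = binom (suc N) (suc k)
  distribute : ∀ k d x → suc (suc k + d) * x ≡ suc d * x + suc k * x
  distribute k d x = solve (k ∷ d ∷ x ∷ [])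

binom-absorb-exchange : ∀ k N m →
  suc N * (binom (suc k) (suc m) * binom N m) ≡ suc k * (binom (suc N) (suc m) * binom k m)
binom-absorb-exchange k N m = exchange _ _ _ _ (binom-absorb k m) (binom-absorb N m)
  where
  exchange : ∀ p q a b → suc m * p ≡ suc k * a → suc m * q ≡ suc N * b → suc N * (p * b) ≡ suc k * (q * a)
  exchange p q a b mp≡ka mq≡Nb = *-cancelˡ-≡ _ _ (suc m) (begin
    suc m * (suc N * (p * b))     ≡⟨ solve (m ∷ N ∷ p ∷ b ∷ []) ⟩
    (suc m * p) * (suc N * b)     ≡⟨ cong (_* (suc N * b)) mp≡ka ⟩
    (suc k * a) * (suc N * b)     ≡⟨ cong ((suc k * a) *_) (sym mq≡Nb) ⟩
    (suc k * a) * (suc m * q)     ≡⟨ solve (m ∷ k ∷ q ∷ a ∷ []) ⟩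
    suc m * (suc k * (q * a))     ∎)

-- Compositions with a prescribed number of parts at least 2

-- compositions none u k m counts the compositions of u into k parts, m of which are at least 2;
-- in state one (many) the part under construction already has one (at least two) units.
compositions : Run → ℕ → ℕ → ℕ → ℕ
compositions none zero zero zero = 1
compositions none zero zero (suc m) = 0
compositions none zero (suc k) m = 0
compositions none (suc u) zero m = 0
compositions none (suc u) (suc k) m = compositions one u (suc k) m
compositions one u zero m = 0
compositions one zero (suc k) m = compositions none zero k m
compositions one (suc u) (suc k) m = compositions none (suc u) k m + compositions many u (suc k) m
compositions many u zero m = 0
compositions many u (suc k) zero = 0
compositions many zero (suc k) (suc m) = compositions none zero k m
compositions many (suc u) (suc k) (suc m) =
  compositions none (suc u) k m + compositions many u (suc k) (suc m)

sumMany : ℕ → ℕ → ℕ → ℕ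
sumMany zero k m = 0
sumMany (suc u) k m = compositions many u k m + sumMany u k m

compositions-none-short : ∀ u k m → u < k → compositions none u k m ≡ 0
compositions-many-short : ∀ u k m → u < k → compositions many u (suc k) m ≡ 0

compositions-none-short zero (suc k) m _ = refl
compositions-none-short (suc zero) (suc zero) m (s≤s ())
compositions-none-short (suc zero) (suc (suc k)) m _ = refl
compositions-none-short (suc (suc u)) (suc k) m (s≤s u+1<k) =
  cong₂ _+_ (compositions-none-short (suc u) k m u+1<k) (compositions-many-short u k m (<⇒≤ u+1<k))

compositions-many-short u k zero _ = refl
compositions-many-short zero (suc k) (suc m) _ = refl
compositions-many-short (suc u) k (suc m) u+1<k =
  cong₂ _+_ (compositions-none-short (suc u) k m u+1<k) (compositions-many-short u k (suc m) (<⇒≤ u+1<k))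

sumMany-short : ∀ u k m → u ≤ k → sumMany u (suc k) m ≡ 0
sumMany-short zero k m _ = refl
sumMany-short (suc u) k m u<k =
  cong₂ _+_ (compositions-many-short u k m u<k) (sumMany-short u k m (<⇒≤ u<k))

compositions-many-no-long : ∀ u k → compositions many u k zero ≡ 0
compositions-many-no-long u zero = refl
compositions-many-no-long u (suc k) = refl

sumMany-no-long : ∀ u k → sumMany u k zero ≡ 0
sumMany-no-long zero k = refl
sumMany-no-long (suc u) k = cong₂ _+_ (compositions-many-no-long u k) (sumMany-no-long u k)

compositions-none-singletons : ∀ k → compositions none (suc k) (suc k) zero ≡ 1
compositions-none-singletons zero = refl
compositions-none-singletons (suc k) =
  cong₂ _+_ (compositions-none-singletons k) (compositions-many-no-long k (suc (suc k)))

compositions-none-singletons-long : ∀ k m → compositions none (suc k) (suc k) (suc m) ≡ 0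
compositions-none-singletons-long zero m = refl
compositions-none-singletons-long (suc k) m =
  cong₂ _+_ (compositions-none-singletons-long k m) (compositions-many-short k (suc k) (suc m) ≤-refl)

compositions-none-no-long : ∀ k e → compositions none (suc (suc (k + e))) (suc k) zero ≡ 0
compositions-none-no-long zero e = refl
compositions-none-no-long (suc k) e =
  cong₂ _+_ (compositions-none-no-long k e) (compositions-many-no-long (suc (k + e)) (suc (suc k)))

compositions-none-closed : ∀ k e m →
  compositions none (suc (suc (k + e))) (suc k) (suc m) ≡ binom (suc k) (suc m) * binom e m
compositions-many-closed : ∀ e k m →
  compositions many (e + k) (suc k) (suc m) ≡ binom k m * binom e m

compositions-none-closed zero e m = begin
  compositions many e 1 (suc m)        ≡⟨ cong (λ u → compositions many u 1 (suc m)) (sym (+-identityʳ e)) ⟩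
  compositions many (e + 0) 1 (suc m)  ≡⟨ compositions-many-closed e zero m ⟩
  binom 0 m * binom e m                ≡⟨ cong (_* binom e m) (sym (+-identityʳ (binom 0 m))) ⟩
  binom 1 (suc m) * binom e m          ∎
compositions-none-closed (suc k) e m = begin
  compositions none (suc (suc (k + e))) (suc k) (suc m) + compositions many (suc k + e) (suc (suc k)) (suc m)
    ≡⟨ cong₂ _+_ (compositions-none-closed k e m)
                 (trans (cong (λ u → compositions many u (suc (suc k)) (suc m)) (+-comm (suc k) e))
                        (compositions-many-closed e (suc k) m)) ⟩
  binom (suc k) (suc m) * binom e m + binom (suc k) m * binom e m
    ≡⟨ sym (*-distribʳ-+ (binom e m) (binom (suc k) (suc m)) (binom (suc k) m)) ⟩
  (binom (suc k) (suc m) + binom (suc k) m) * binom e m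
    ≡⟨ cong (_* binom e m) (+-comm (binom (suc k) (suc m)) (binom (suc k) m)) ⟩
  binom (suc (suc k)) (suc m) * binom e m ∎

compositions-many-closed zero zero zero = refl
compositions-many-closed zero zero (suc m) = refl
compositions-many-closed zero (suc k) zero =
  cong₂ _+_ (compositions-none-singletons k) (compositions-many-short k (suc k) 1 ≤-refl)
compositions-many-closed zero (suc k) (suc m) =
  trans (cong₂ _+_ (compositions-none-singletons-long k m) (compositions-many-short k (suc k) (suc (suc m)) ≤-refl))
        (sym (*-zeroʳ (binom (suc k) (suc m))))
compositions-many-closed (suc e) zero zero = compositions-many-closed e zero zero
compositions-many-closed (suc e) (suc k) zero =
  cong₂ _+_ (trans (cong (λ u → compositions none (suc u) (suc k) zero) (trans (+-suc e k) (cong suc (+-comm e k))))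
                   (compositions-none-no-long k e))
            (compositions-many-closed e (suc k) zero)
compositions-many-closed (suc e) zero (suc m) = compositions-many-closed e zero (suc m)
compositions-many-closed (suc e) (suc k) (suc m) = begin
  compositions none (suc (e + suc k)) (suc k) (suc m) + compositions many (e + suc k) (suc (suc k)) (suc (suc m))
    ≡⟨ cong₂ _+_ (trans (cong (λ u → compositions none (suc u) (suc k) (suc m))
                               (trans (+-suc e k) (cong suc (+-comm e k))))
                        (compositions-none-closed k e m))
                 (compositions-many-closed e (suc k) (suc m)) ⟩
  binom (suc k) (suc m) * binom e m + binom (suc k) (suc m) * binom e (suc m)
    ≡⟨ sym (*-distribˡ-+ (binom (suc k) (suc m)) (binom e m) (binom e (suc m))) ⟩
  binom (suc k) (suc m) * binom (suc e) (suc m) ∎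

sumMany-closed : ∀ e k m → sumMany (e + k) (suc k) (suc m) ≡ binom k m * binom e (suc m)
sumMany-closed zero k m = trans (sumMany-short k k (suc m) ≤-refl) (sym (*-zeroʳ (binom k m)))
sumMany-closed (suc e) k m = begin
  compositions many (e + k) (suc k) (suc m) + sumMany (e + k) (suc k) (suc m)
    ≡⟨ cong₂ _+_ (compositions-many-closed e k m) (sumMany-closed e k m) ⟩
  binom k m * binom e m + binom k m * binom e (suc m)
    ≡⟨ sym (*-distribˡ-+ (binom k m) (binom e m) (binom e (suc m))) ⟩
  binom k m * binom (suc e) (suc m) ∎

sumMany-compositions : ∀ u k m →
  suc k * (compositions none (suc u) (suc k) m + sumMany u (suc k) m)
    ≡ suc u * compositions none (suc u) (suc k) m
sumMany-compositions u k m with compare u k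
sumMany-compositions u .(suc (u + e)) m | less .u e
  rewrite compositions-none-short (suc u) (suc (suc (u + e))) m (s≤s (s≤s (m≤m+n u e)))
        | sumMany-short u (suc (u + e)) m (m≤n⇒m≤1+n (m≤m+n u e)) =
  trans (*-zeroʳ (suc (suc (u + e)))) (sym (*-zeroʳ (suc u)))
sumMany-compositions u .u zero | equal .u
  rewrite compositions-none-singletons u | sumMany-no-long u (suc u) = refl
sumMany-compositions u .u (suc m) | equal .u
  rewrite compositions-none-singletons-long u m | sumMany-short u u (suc m) ≤-refl =
  trans (*-zeroʳ (suc u)) (sym (*-zeroʳ (suc u)))
sumMany-compositions .(suc (k + e)) k zero | greater .k e
  rewrite compositions-none-no-long k e | sumMany-no-long (suc (k + e)) (suc k) =
  trans (*-zeroʳ (suc k)) (sym (*-zeroʳ (suc (suc (k + e)))))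
sumMany-compositions .(suc (k + e)) k (suc m) | greater .k e = begin
  suc k * (compositions none (suc (suc (k + e))) (suc k) (suc m) + sumMany (suc (k + e)) (suc k) (suc m))
    ≡⟨ cong₂ (λ c s → suc k * (c + s)) (compositions-none-closed k e m)
             (trans (cong (λ u → sumMany (suc u) (suc k) (suc m)) (+-comm k e)) (sumMany-closed (suc e) k m)) ⟩
  suc k * (p * b + a * q)
    ≡⟨ combine p q a b (binom-absorb k m) (binom-absorb e m) ⟩
  suc (suc (k + e)) * (p * b)
    ≡⟨ cong (suc (suc (k + e)) *_) (sym (compositions-none-closed k e m)) ⟩
  suc (suc (k + e)) * compositions none (suc (suc (k + e))) (suc k) (suc m) ∎
  where
  p q a b : ℕ
  p = binom (suc k) (suc m)
  q = binom (suc e) (suc m)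
  a = binom k m
  b = binom e m
  combine : ∀ p q a b → suc m * p ≡ suc k * a → suc m * q ≡ suc e * b →
            suc k * (p * b + a * q) ≡ suc (suc (k + e)) * (p * b)
  combine p q a b mp≡ka mq≡eb = *-cancelˡ-≡ _ _ (suc m) (begin
    suc m * (suc k * (p * b + a * q))            ≡⟨ solve (m ∷ k ∷ p ∷ q ∷ a ∷ b ∷ []) ⟩
    suc k * ((suc m * p) * b + a * (suc m * q))  ≡⟨ cong₂ (λ x y → suc k * (x * b + a * y)) mp≡ka mq≡eb ⟩
    suc k * ((suc k * a) * b + a * (suc e * b))  ≡⟨ solve (k ∷ e ∷ a ∷ b ∷ []) ⟩
    suc (suc (k + e)) * ((suc k * a) * b)        ≡⟨ cong (λ x → suc (suc (k + e)) * (x * b)) (sym mp≡ka) ⟩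
    suc (suc (k + e)) * ((suc m * p) * b)        ≡⟨ solve (m ∷ k ∷ e ∷ p ∷ b ∷ []) ⟩
    suc m * (suc (suc (k + e)) * (p * b))        ∎)

-- The generalized ballot formula

paths-no-up : ∀ h k m → paths none h zero k m ≡ compositions none zero k m
paths-no-up zero zero zero = refl
paths-no-up zero zero (suc m) = refl
paths-no-up zero (suc k) m = refl
paths-no-up (suc h) k m = paths-no-up h k m

paths-many-no-peak : ∀ h u m → paths many (suc h) u zero m ≡ 0
paths-many-no-peak h zero m = refl
paths-many-no-peak h (suc u) m = trans (+-identityʳ _) (paths-many-no-peak (suc h) u m)

paths-one-no-peak : ∀ h u m → paths one (suc h) u zero m ≡ 0
paths-one-no-peak h zero m = refl
paths-one-no-peak h (suc u) m = trans (+-identityʳ _) (paths-many-no-peak (suc h) u m)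

paths-none-no-peak : ∀ h u m → paths none h u zero m ≡ compositions none u zero m
paths-none-no-peak h zero m = paths-no-up h zero m
paths-none-no-peak zero (suc u) m = paths-one-no-peak zero u m
paths-none-no-peak (suc h) (suc u) m =
  cong₂ _+_ (paths-one-no-peak (suc h) u m) (paths-none-no-peak h (suc u) m)

no-up-formula : ∀ h k m →
  suc h * compositions none zero k m ≡ binom (suc h) k * (suc h * compositions none zero k m + 0)
no-up-formula h zero m = sym (trans (*-identityˡ _) (+-identityʳ _))
no-up-formula h (suc k) m = vanish (suc h) (binom (suc h) (suc k))
  where
  vanish : ∀ a b → a * 0 ≡ b * (a * 0 + 0)
  vanish a b = solve (a ∷ b ∷ [])

continue-or-close : ∀ u h k P₂ P₀ c₂ d c₀ →
  suc (u + suc h) * P₂ ≡ binom (suc (u + suc h)) k * (suc (suc h) * c₂ + d) →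
  suc (suc u + h) * P₀ ≡ binom (suc (suc u + h)) k * (suc h * c₀) →
  suc (suc u + h) * (P₂ + P₀) ≡ binom (suc (suc u + h)) k * (suc h * (c₀ + c₂) + (c₂ + d))
continue-or-close u h k P₂ P₀ c₂ d c₀ continued closed = begin
  M * (P₂ + P₀)                                  ≡⟨ *-distribˡ-+ M P₂ P₀ ⟩
  M * P₂ + M * P₀                                ≡⟨ cong₂ _+_ continued′ closed ⟩
  B * (suc (suc h) * c₂ + d) + B * (suc h * c₀)  ≡⟨ regroup B h c₂ d c₀ ⟩
  B * (suc h * (c₀ + c₂) + (c₂ + d))             ∎
  where
  M B : ℕ
  M = suc (suc u + h)
  B = binom M k
  continued′ : M * P₂ ≡ B * (suc (suc h) * c₂ + d)
  continued′ = subst (λ n → suc n * P₂ ≡ binom (suc n) k * (suc (suc h) * c₂ + d)) (+-suc u h) continued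
  regroup : ∀ b h x y z →
    b * (suc (suc h) * x + y) + b * (suc h * z) ≡ b * (suc h * (z + x) + (x + y))
  regroup b h x y z = solve (b ∷ h ∷ x ∷ y ∷ z ∷ [])

ballot-combine : ∀ h k e c d Bₘ Bₚ → suc k * (c + d) ≡ suc (k + e) * c →
  suc (k + e + suc h) * Bₚ ≡ suc (suc (e + h)) * Bₘ →
  suc k * (Bₘ * (suc (suc h) * c + d)) + suc (k + e + suc h) * (Bₚ * (suc h * c))
    ≡ suc (k + e + suc h) * (Bₘ * (suc (suc h) * c))
ballot-combine h k e c d Bₘ Bₚ kd≡uc MBₚ≡ = begin
  suc k * (Bₘ * (suc (suc h) * c + d)) + suc (k + e + suc h) * (Bₚ * (suc h * c))
    ≡⟨ expand c d Bₘ Bₚ ⟩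
  Bₘ * (suc k * (suc h * c) + suc k * (c + d)) + (suc (k + e + suc h) * Bₚ) * (suc h * c)
    ≡⟨ cong₂ (λ x y → Bₘ * (suc k * (suc h * c) + x) + y * (suc h * c)) kd≡uc MBₚ≡ ⟩
  Bₘ * (suc k * (suc h * c) + suc (k + e) * c) + (suc (suc (e + h)) * Bₘ) * (suc h * c)
    ≡⟨ collect c Bₘ ⟩
  suc (k + e + suc h) * (Bₘ * (suc (suc h) * c)) ∎
  where
  expand : ∀ c d Bₘ Bₚ →
    suc k * (Bₘ * (suc (suc h) * c + d)) + suc (k + e + suc h) * (Bₚ * (suc h * c))
      ≡ Bₘ * (suc k * (suc h * c) + suc k * (c + d)) + (suc (k + e + suc h) * Bₚ) * (suc h * c)
  expand c d Bₘ Bₚ = solve (k ∷ e ∷ h ∷ c ∷ d ∷ Bₘ ∷ Bₚ ∷ [])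
  collect : ∀ c Bₘ →
    Bₘ * (suc k * (suc h * c) + suc (k + e) * c) + (suc (suc (e + h)) * Bₘ) * (suc h * c)
      ≡ suc (k + e + suc h) * (Bₘ * (suc (suc h) * c))
  collect c Bₘ = solve (k ∷ e ∷ h ∷ c ∷ Bₘ ∷ [])

ballot-step : ∀ h u k m →
  let M = suc (u + suc h)
      c = compositions none (suc u) (suc k) m
  in suc k * (binom M k * (suc (suc h) * c + sumMany u (suc k) m))
       + M * (binom (suc u + h) k * (suc h * c))
     ≡ M * (binom M k * (suc (suc h) * c))
ballot-step h u k m with <-≤-connex u k
... | inj₁ u<k
  rewrite compositions-none-short (suc u) (suc k) m (s≤s u<k) | sumMany-short u k m (<⇒≤ u<k) =
    vanish (suc k) (binom (suc (u + suc h)) k) (suc (u + suc h)) (binom (suc u + h) k) (suc (suc h)) (suc h)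
  where
  vanish : ∀ a b p q r s → a * (b * (r * 0 + 0)) + p * (q * (s * 0)) ≡ p * (b * (r * 0))
  vanish a b p q r s = solve (a ∷ b ∷ p ∷ q ∷ r ∷ s ∷ [])
... | inj₂ k≤u with e , refl ← m≤n⇒∃[o]m+o≡n k≤u =
  ballot-combine h k e (compositions none (suc (k + e)) (suc k) m) (sumMany (k + e) (suc k) m)
                 (binom (suc (k + e + suc h)) k) (binom (suc (k + e + h)) k)
                 (sumMany-compositions (k + e) k m) absorbed
  where
  absorbed : suc (k + e + suc h) * binom (suc (k + e + h)) k
             ≡ suc (suc (e + h)) * binom (suc (k + e + suc h)) k
  absorbed = subst₂ (λ a b → suc a * binom b k ≡ suc (suc (e + h)) * binom (suc a) k)
                    top bottom (binom-absorb-complement k (suc (e + h)))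
    where
    top : k + suc (e + h) ≡ k + e + suc h
    top = solve (k ∷ e ∷ h ∷ [])
    bottom : k + suc (e + h) ≡ suc (k + e + h)
    bottom = solve (k ∷ e ∷ h ∷ [])

paths-none-formula : ∀ h u k m →
  suc k * paths none h u (suc k) m ≡ binom (u + h) k * (suc h * compositions none u (suc k) m)
paths-one-formula : ∀ h u k m →
  suc (u + h) * paths one (suc h) u (suc k) m
    ≡ binom (suc (u + h)) k * (suc h * compositions one u (suc k) m + sumMany u (suc k) m)
paths-many-formula : ∀ h u k m →
  suc (u + h) * paths many (suc h) u (suc k) m
    ≡ binom (suc (u + h)) k * (suc h * compositions many u (suc k) m + sumMany u (suc k) m)
paths-none-formula′ : ∀ h u k m →
  suc (suc (u + h)) * paths none h (suc u) k m
    ≡ binom (suc (suc (u + h))) k * (suc h * compositions none (suc u) k m)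

paths-none-formula h zero k m = begin
  suc k * paths none h zero (suc k) m  ≡⟨ cong (suc k *_) (paths-no-up h (suc k) m) ⟩
  suc k * 0                            ≡⟨ *-zeroʳ (suc k) ⟩
  0                                    ≡⟨ sym (*-zeroʳ (binom h k)) ⟩
  binom h k * 0                        ≡⟨ cong (binom h k *_) (sym (*-zeroʳ (suc h))) ⟩
  binom h k * (suc h * 0)              ∎
paths-none-formula zero (suc u) k m = *-cancelˡ-≡ _ _ (suc u) (begin
  suc u * (suc k * P)                  ≡⟨ x∙yz≈y∙xz (suc u) (suc k) P ⟩
  suc k * (suc u * P)                  ≡⟨ cong (λ n → suc k * (suc n * P)) (sym (+-identityʳ u)) ⟩
  suc k * (suc (u + 0) * P)            ≡⟨ cong (suc k *_) (paths-one-formula zero u k m) ⟩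
  suc k * (B * (1 * c + d))            ≡⟨ x∙yz≈y∙xz (suc k) B (1 * c + d) ⟩
  B * (suc k * (1 * c + d))            ≡⟨ cong (λ x → B * (suc k * (x + d))) (*-identityˡ c) ⟩
  B * (suc k * (c + d))                ≡⟨ cong (B *_) (sumMany-compositions u k m) ⟩
  B * (suc u * c)                      ≡⟨ x∙yz≈y∙xz B (suc u) c ⟩
  suc u * (B * c)                      ≡⟨ cong (λ x → suc u * (B * x)) (sym (*-identityˡ c)) ⟩
  suc u * (B * (1 * c))                ∎)
  where
  P B c d : ℕ
  P = paths one 1 u (suc k) m
  B = binom (suc (u + 0)) k
  c = compositions one u (suc k) m
  d = sumMany u (suc k) m
paths-none-formula (suc h) (suc u) k m = *-cancelˡ-≡ _ _ M (begin
  M * (suc k * (P₁ + P₀))                  ≡⟨ spread M (suc k) P₁ P₀ ⟩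
  suc k * (M * P₁) + M * (suc k * P₀)      ≡⟨ cong₂ (λ a b → suc k * a + M * b) (paths-one-formula (suc h) u k m)
                                                                             (paths-none-formula h (suc u) k m) ⟩
  suc k * (binom M k * (suc (suc h) * c + sumMany u (suc k) m)) + M * (binom (suc u + h) k * (suc h * c))
    ≡⟨ ballot-step h u k m ⟩
  M * (binom M k * (suc (suc h) * c))      ∎)
  where
  M P₁ P₀ c : ℕ
  M = suc (u + suc h)
  P₁ = paths one (suc (suc h)) u (suc k) m
  P₀ = paths none h (suc u) (suc k) m
  c = compositions none (suc u) (suc k) m
  spread : ∀ x y a b → x * (y * (a + b)) ≡ y * (x * a) + x * (y * b)
  spread x y a b = solve (x ∷ y ∷ a ∷ b ∷ [])

paths-one-formula h zero k m = trans (cong (suc h *_) (paths-no-up h k m)) (no-up-formula h k m)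
paths-one-formula h (suc u) k m =
  continue-or-close u h k _ _ _ _ _ (paths-many-formula (suc h) u k m) (paths-none-formula′ h u k m)

paths-many-formula h zero k zero = vanish (suc h) (binom (suc h) k)
  where
  vanish : ∀ a b → a * 0 ≡ b * (a * 0 + 0)
  vanish a b = solve (a ∷ b ∷ [])
paths-many-formula h zero k (suc m) = trans (cong (suc h *_) (paths-no-up h k m)) (no-up-formula h k m)
paths-many-formula h (suc u) k zero =
  continue-or-close u h k (paths many (suc (suc h)) u (suc k) zero) 0 0 (sumMany u (suc k) zero) 0
    (paths-many-formula (suc h) u k zero) (vanish (suc (suc u + h)) (binom (suc (suc u + h)) k) h)
  where
  vanish : ∀ a b h → a * 0 ≡ b * (suc h * 0)
  vanish a b h = solve (a ∷ b ∷ h ∷ [])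
paths-many-formula h (suc u) k (suc m) =
  continue-or-close u h k _ _ _ _ _ (paths-many-formula (suc h) u k (suc m)) (paths-none-formula′ h u k m)

paths-none-formula′ h u zero m = begin
  M * paths none h (suc u) zero m        ≡⟨ cong (M *_) (paths-none-no-peak h (suc u) m) ⟩
  M * 0                                  ≡⟨ vanish M h ⟩
  1 * (suc h * 0)                        ∎
  where
  M : ℕ
  M = suc (suc (u + h))
  vanish : ∀ a h → a * 0 ≡ 1 * (suc h * 0)
  vanish a h = solve (a ∷ h ∷ [])
paths-none-formula′ h u (suc k) m = *-cancelˡ-≡ _ _ (suc k) (begin
  suc k * (M * P₀)                       ≡⟨ x∙yz≈y∙xz (suc k) M P₀ ⟩
  M * (suc k * P₀)                       ≡⟨ cong (M *_) (paths-none-formula h (suc u) k m) ⟩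
  M * (binom (suc u + h) k * X)          ≡⟨ sym (*-assoc M (binom (suc u + h) k) X) ⟩
  (M * binom (suc u + h) k) * X          ≡⟨ cong (_* X) (sym (binom-absorb (suc u + h) k)) ⟩
  (suc k * binom M (suc k)) * X          ≡⟨ *-assoc (suc k) (binom M (suc k)) X ⟩
  suc k * (binom M (suc k) * X)          ∎)
  where
  M P₀ X : ℕ
  M = suc (suc (u + h))
  P₀ = paths none h (suc u) (suc k) m
  X = suc h * compositions none (suc u) (suc k) m

w-compositions : ∀ n k m → suc k * w n (suc k) m ≡ (n C k) * compositions none n (suc k) m
w-compositions n k m = begin
  suc k * w n (suc k) m                              ≡⟨ cong (suc k *_) (w≡paths n (suc k) m) ⟩
  suc k * paths none 0 n (suc k) m                   ≡⟨ paths-none-formula 0 n k m ⟩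
  binom (n + 0) k * (1 * compositions none n (suc k) m)
    ≡⟨ cong₂ (λ a b → binom a k * b) (+-identityʳ n) (*-identityˡ _) ⟩
  binom n k * compositions none n (suc k) m          ≡⟨ cong (_* compositions none n (suc k) m) (binom≡C n k) ⟩
  (n C k) * compositions none n (suc k) m            ∎

-- The Narayana numbers

compositions-none-C : ∀ k t m →
  compositions none (suc k + t) (suc k) m ≡ (suc k C m) * binomZ (+ t -ℤ + 1) (+ m -ℤ + 1)
compositions-none-C k zero zero = begin
  compositions none (suc k + 0) (suc k) zero
    ≡⟨ cong (λ n → compositions none n (suc k) zero) (+-identityʳ (suc k)) ⟩
  compositions none (suc k) (suc k) zero
    ≡⟨ compositions-none-singletons k ⟩
  binom (suc k) 0 * 1
    ≡⟨ cong (_* 1) (binom≡C (suc k) 0) ⟩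
  (suc k C 0) * 1 ∎
compositions-none-C k zero (suc m) = begin
  compositions none (suc k + 0) (suc k) (suc m)
    ≡⟨ cong (λ n → compositions none n (suc k) (suc m)) (+-identityʳ (suc k)) ⟩
  compositions none (suc k) (suc k) (suc m)
    ≡⟨ compositions-none-singletons-long k m ⟩
  0
    ≡⟨ sym (*-zeroʳ (suc k C suc m)) ⟩
  (suc k C suc m) * 0 ∎
compositions-none-C k (suc t) zero = begin
  compositions none (suc k + suc t) (suc k) zero
    ≡⟨ cong (λ n → compositions none n (suc k) zero) (+-suc (suc k) t) ⟩
  compositions none (suc (suc k + t)) (suc k) zero
    ≡⟨ compositions-none-no-long k t ⟩
  0
    ≡⟨ sym (*-zeroʳ (suc k C 0)) ⟩
  (suc k C 0) * 0 ∎
compositions-none-C k (suc t) (suc m) = begin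
  compositions none (suc k + suc t) (suc k) (suc m)
    ≡⟨ cong (λ n → compositions none n (suc k) (suc m)) (+-suc (suc k) t) ⟩
  compositions none (suc (suc k + t)) (suc k) (suc m)
    ≡⟨ compositions-none-closed k t m ⟩
  binom (suc k) (suc m) * binom t m
    ≡⟨ cong₂ _*_ (binom≡C (suc k) (suc m)) (binom≡C t m) ⟩
  (suc k C suc m) * (t C m) ∎

C-absorb-exchange : ∀ k N m →
  suc N * ((suc k C m) * binomZ (+ N) (+ m -ℤ + 1)) ≡ suc k * ((suc N C m) * binomZ (+ k) (+ m -ℤ + 1))
C-absorb-exchange k N zero = begin
  suc N * ((suc k C 0) * 0)  ≡⟨ cong (suc N *_) (*-zeroʳ (suc k C 0)) ⟩
  suc N * 0                  ≡⟨ *-zeroʳ (suc N) ⟩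
  0                          ≡⟨ sym (*-zeroʳ (suc k)) ⟩
  suc k * 0                  ≡⟨ cong (suc k *_) (sym (*-zeroʳ (suc N C 0))) ⟩
  suc k * ((suc N C 0) * 0)  ∎
C-absorb-exchange k N (suc m) = begin
  suc N * ((suc k C suc m) * (N C m))
    ≡⟨ cong (suc N *_) (sym (cong₂ _*_ (binom≡C (suc k) (suc m)) (binom≡C N m))) ⟩
  suc N * (binom (suc k) (suc m) * binom N m)
    ≡⟨ binom-absorb-exchange k N m ⟩
  suc k * (binom (suc N) (suc m) * binom k m)
    ≡⟨ cong (suc k *_) (cong₂ _*_ (binom≡C (suc N) (suc m)) (binom≡C k m)) ⟩
  suc k * ((suc N C suc m) * (k C m)) ∎

fromℚᵘ-homo-* : ∀ p q → fromℚᵘ (p *ᵘ q) ≡ fromℚᵘ p *ℚ fromℚᵘ q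
fromℚᵘ-homo-* p q = ℚ.toℚᵘ-injective (ℚᵘ.≃-trans (ℚ.toℚᵘ-fromℚᵘ (p *ᵘ q))
  (ℚᵘ.≃-trans (ℚᵘ.*-cong (ℚᵘ.≃-sym (ℚ.toℚᵘ-fromℚᵘ p)) (ℚᵘ.≃-sym (ℚ.toℚᵘ-fromℚᵘ q)))
              (ℚᵘ.≃-sym (ℚ.toℚᵘ-homo-* (fromℚᵘ p) (fromℚᵘ q)))))

toℚ-homo-* : ∀ a b → toℚ (a * b) ≡ toℚ a *ℚ toℚ b
toℚ-homo-* a b =
  trans (cong (λ z → fromℚᵘ (mkℚᵘ z 0)) (ℤ.pos-* a b)) (fromℚᵘ-homo-* (mkℚᵘ (+ a) 0) (mkℚᵘ (+ b) 0))

recip-inverseˡ : ∀ n → recip (suc n) *ℚ toℚ (suc n) ≡ 1ℚ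
recip-inverseˡ n = trans (sym (fromℚᵘ-homo-* (mkℚᵘ (+ 1) n) (mkℚᵘ (+ suc n) 0)))
                         (ℚ.fromℚᵘ-cong (ℚᵘ.*-inverseˡ (mkℚᵘ (+ suc n) 0)))

toℚ-divide : ∀ K x y → suc K * x ≡ y → toℚ x ≡ recip (suc K) *ℚ toℚ y
toℚ-divide K x y Kx≡y = begin
  toℚ x                                      ≡⟨ sym (ℚ.*-identityˡ (toℚ x)) ⟩
  1ℚ *ℚ toℚ x                                ≡⟨ cong (_*ℚ toℚ x) (sym (recip-inverseˡ K)) ⟩
  (recip (suc K) *ℚ toℚ (suc K)) *ℚ toℚ x    ≡⟨ ℚ.*-assoc (recip (suc K)) (toℚ (suc K)) (toℚ x) ⟩
  recip (suc K) *ℚ (toℚ (suc K) *ℚ toℚ x)    ≡⟨ cong (recip (suc K) *ℚ_) (sym (toℚ-homo-* (suc K) x)) ⟩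
  recip (suc K) *ℚ toℚ (suc K * x)           ≡⟨ cong (λ z → recip (suc K) *ℚ toℚ z) Kx≡y ⟩
  recip (suc K) *ℚ toℚ y                     ∎

-- The factor j of the generalized Narayana number cancels against the prefactor 1/j.
toℚ-cancel : ∀ x b c d K j → suc K * x ≡ b * (c * d) →
  toℚ x ≡ (recip (suc j) *ℚ toℚ b) *ℚ (((toℚ (suc j) *ℚ recip (suc K)) *ℚ toℚ c) *ℚ toℚ d)
toℚ-cancel x b c d K j Kx≡bcd = begin
  toℚ x
    ≡⟨ toℚ-divide K x (b * (c * d)) Kx≡bcd ⟩
  rK *ℚ toℚ (b * (c * d))
    ≡⟨ cong (rK *ℚ_) (trans (toℚ-homo-* b (c * d)) (cong (toℚ b *ℚ_) (toℚ-homo-* c d))) ⟩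
  rK *ℚ bcd
    ≡⟨ sym (ℚ.*-identityˡ _) ⟩
  1ℚ *ℚ (rK *ℚ bcd)
    ≡⟨ cong (_*ℚ (rK *ℚ bcd)) (sym (recip-inverseˡ j)) ⟩
  (rj *ℚ toℚ (suc j)) *ℚ (rK *ℚ bcd)
    ≡⟨ ℚ-solve 6 (λ rj tj rK tb tc td →
                    (rj ⊕ tj) ⊕ (rK ⊕ (tb ⊕ (tc ⊕ td))) ⊜ (rj ⊕ tb) ⊕ (((tj ⊕ rK) ⊕ tc) ⊕ td))
                 refl rj (toℚ (suc j)) rK (toℚ b) (toℚ c) (toℚ d) ⟩
  (rj *ℚ toℚ b) *ℚ (((toℚ (suc j) *ℚ rK) *ℚ toℚ c) *ℚ toℚ d) ∎
  where
  rj rK bcd : ℚ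
  rj = recip (suc j)
  rK = recip (suc K)
  bcd = toℚ b *ℚ (toℚ c *ℚ toℚ d)

binomZ-vanishes : ∀ s i → s < i → binomZ (+ s -ℤ + 1) (+ i -ℤ + 1) ≡ 0
binomZ-vanishes zero (suc i) _ = refl
binomZ-vanishes (suc s) (suc i) (s≤s s<i) = k>n⇒nCk≡0 s<i

-- Where the guard in narayana fires, the binomial factor vanishes anyway.
narayana-closed : ∀ r s n i → r + s ≡ n →
  narayana r n i ≡ toℚ (suc r) *ℚ recip (suc n) *ℚ toℚ (suc n C i) *ℚ toℚ (binomZ (+ s -ℤ + 1) (+ i -ℤ + 1))
narayana-closed r s .(r + s) i refl = begin
  narayana r (r + s) i
    ≡⟨ cong₂ (λ a b → if a <ᵇ i then 0ℚ else value (binomZ (b -ℤ + 1) (+ i -ℤ + 1)))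
             (m+n∸m≡n r s) difference ⟩
  (if s <ᵇ i then 0ℚ else value (binomZ (+ s -ℤ + 1) (+ i -ℤ + 1)))
    ≡⟨ unguard ⟩
  value (binomZ (+ s -ℤ + 1) (+ i -ℤ + 1)) ∎
  where
  value : ℕ → ℚ
  value b = toℚ (suc r) *ℚ recip (suc (r + s)) *ℚ toℚ (suc (r + s) C i) *ℚ toℚ b
  difference : + (r + s) -ℤ + r ≡ + s
  difference = trans (ℤ.m-n≡m⊖n (r + s) r) (trans (ℤ.⊖-≥ (m≤m+n r s)) (cong +_ (m+n∸m≡n r s)))
  unguard : (if s <ᵇ i then 0ℚ else value (binomZ (+ s -ℤ + 1) (+ i -ℤ + 1)))
            ≡ value (binomZ (+ s -ℤ + 1) (+ i -ℤ + 1))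
  unguard with s <ᵇ i in s<ᵇi
  ... | false = refl
  ... | true = sym (trans (cong value (binomZ-vanishes s i (<ᵇ⇒< s i (subst T (sym s<ᵇi) tt))))
                          (ℚ.*-zeroʳ (toℚ (suc r) *ℚ recip (suc (r + s)) *ℚ toℚ (suc (r + s) C i))))

toℚ-w[2k+j] : (j k m : ℕ) → 1 ≤ j → 1 ≤ k →
  toℚ (w (2 * k + j) k m) ≡ (recip j *ℚ toℚ ((2 * k + j) C (k ∸ 1))) *ℚ narayana (j ∸ 1) (k + j ∸ 1) m
toℚ-w[2k+j] (suc j) (suc k) m _ _ = begin
  toℚ (w n (suc k) m)
    ≡⟨ toℚ-cancel (w n (suc k) m) (n C k) (suc N C m) (binomZ (+ k) (+ m -ℤ + 1)) N j scaled ⟩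
  prefactor *ℚ ((toℚ (suc j) *ℚ recip (suc N) *ℚ toℚ (suc N C m)) *ℚ toℚ (binomZ (+ k) (+ m -ℤ + 1)))
    ≡⟨ cong (prefactor *ℚ_) (sym (narayana-closed j (suc k) N m (shift j k))) ⟩
  prefactor *ℚ narayana j N m ∎
  where
  n N : ℕ
  prefactor : ℚ
  n = 2 * suc k + suc j
  N = k + suc j
  prefactor = recip (suc j) *ℚ toℚ (n C k)
  shift : ∀ j k → j + suc k ≡ k + suc j
  shift j k = solve (j ∷ k ∷ [])
  split : ∀ k j → 2 * suc k + suc j ≡ suc k + suc (k + suc j)
  split k j = solve (k ∷ j ∷ [])
  scaled : suc N * w n (suc k) m ≡ (n C k) * ((suc N C m) * binomZ (+ k) (+ m -ℤ + 1))
  scaled = *-cancelˡ-≡ _ _ (suc k) (begin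
    suc k * (suc N * w n (suc k) m)
      ≡⟨ x∙yz≈y∙xz (suc k) (suc N) (w n (suc k) m) ⟩
    suc N * (suc k * w n (suc k) m)
      ≡⟨ cong (suc N *_) (w-compositions n k m) ⟩
    suc N * ((n C k) * compositions none n (suc k) m)
      ≡⟨ x∙yz≈y∙xz (suc N) (n C k) _ ⟩
    (n C k) * (suc N * compositions none n (suc k) m)
      ≡⟨ cong (λ c → (n C k) * (suc N * c))
              (trans (cong (λ n → compositions none n (suc k) m) (split k j)) (compositions-none-C k (suc N) m)) ⟩
    (n C k) * (suc N * ((suc k C m) * binomZ (+ N) (+ m -ℤ + 1)))
      ≡⟨ cong ((n C k) *_) (C-absorb-exchange k N m) ⟩
    (n C k) * (suc k * ((suc N C m) * binomZ (+ k) (+ m -ℤ + 1)))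
      ≡⟨ x∙yz≈y∙xz (n C k) (suc k) _ ⟩
    suc k * ((n C k) * ((suc N C m) * binomZ (+ k) (+ m -ℤ + 1))) ∎)

toℚ-w[2k∸j] : (j k m : ℕ) → 1 ≤ j → j ≤ k →
  toℚ (w (2 * k ∸ j) k m) ≡ (recip j *ℚ toℚ ((2 * k ∸ j) C (k ∸ 1))) *ℚ narayana (j ∸ 1) (k ∸ 1) m
toℚ-w[2k∸j] (suc j) (suc k) m _ (s≤s j≤k) with t , refl ← m≤n⇒∃[o]m+o≡n j≤k = begin
  toℚ (w n (suc K) m)
    ≡⟨ toℚ-cancel (w n (suc K) m) (n C K) (suc K C m) (binomZ (+ t -ℤ + 1) (+ m -ℤ + 1)) K j scaled ⟩
  prefactor *ℚ ((toℚ (suc j) *ℚ recip (suc K) *ℚ toℚ (suc K C m)) *ℚ toℚ (binomZ (+ t -ℤ + 1) (+ m -ℤ + 1)))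
    ≡⟨ cong (prefactor *ℚ_) (sym (narayana-closed j t K m refl)) ⟩
  prefactor *ℚ narayana j K m ∎
  where
  K n : ℕ
  prefactor : ℚ
  K = j + t
  n = 2 * suc K ∸ suc j
  prefactor = recip (suc j) *ℚ toℚ (n C K)
  double : ∀ j t → 2 * suc (j + t) ≡ suc j + (suc (j + t) + t)
  double j t = solve (j ∷ t ∷ [])
  split : n ≡ suc K + t
  split = trans (cong (_∸ suc j) (double j t)) (m+n∸m≡n (suc j) (suc K + t))
  scaled : suc K * w n (suc K) m ≡ (n C K) * ((suc K C m) * binomZ (+ t -ℤ + 1) (+ m -ℤ + 1))
  scaled = trans (w-compositions n K m)
                 (cong ((n C K) *_) (trans (cong (λ n → compositions none n (suc K) m) split)
                                           (compositions-none-C K t m)))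

theorem5p3 : ((j k m : ℕ) → 1 ≤ j → 1 ≤ k →
    toℚ (w (2 * k + j) k m)
      ≡ Data.Rational._*_ (Data.Rational._*_ (recip j) (toℚ ((2 * k + j) C (k ∸ 1))))
                           (narayana (j ∸ 1) (k + j ∸ 1) m))
  ×
  ((j k m : ℕ) → 1 ≤ j → j ≤ k →
    toℚ (w (2 * k ∸ j) k m)
      ≡ Data.Rational._*_ (Data.Rational._*_ (recip j) (toℚ ((2 * k ∸ j) C (k ∸ 1))))
                           (narayana (j ∸ 1) (k ∸ 1) m))
theorem5p3 = toℚ-w[2k+j] , toℚ-w[2k∸j]
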